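{- Let $G$ be a connected graph of order $n$, let $\alpha$ be an ordering of $G$, and let $(\{x\},Y)$ be an $\alpha$-consecutive pair such that every vertex in $Y$ has degree $1$ and is adjacent to $x$. Then for $\beta=\mathrm{swap}_{Y,\{x\}}(\alpha)$ we have $\mathrm{prf}_\beta(G)\le\mathrm{prf}_\alpha(G)$.
   Context: An ordering of $G=(V,E)$ is a bijection $\alpha:V\to\{1,\dots,n\}$; with $N[v]=\{v\}\cup\{u:uv\in E\}$, $\mathrm{prf}_\alpha(G)=\sum_{v\in V}(\alpha(v)-\min\{\alpha(u):u\in N[v]\})$. Two disjoint sets $X,Y\subseteq V$ form an $\alpha$-consecutive pair $(X,Y)$ if there are integers $1\le a<b<c\le n$ with $X=\{x:a\le\alpha(x)\le b-1\}$ and $Y=\{y: b\le \alpha(y)\le c\}$. Then $\mathrm{swap}_{Y,X}(\alpha)$ is the ordering that agrees with $\alpha$ outside $X\cup Y$, places the vertices of $Y$ at positions $a,\dots,a+|Y|-1$ and those of $X$ at positions $a+|Y|,\dots,c$, each block keeping its internal relative order. -}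

module Defs where

open import Data.Nat using (ℕ; zero; suc; _+_; _∸_; _⊓_; _≤_; _≤ᵇ_)
open import Data.Bool using (Bool; true; false; if_then_else_; _∧_)
open import Data.Fin using (Fin; toℕ)
open import Data.Fin.Permutation using (Permutation′; _⟨$⟩ʳ_)
open import Data.List using (List; allFin; foldr; map; filter; length)
open import Data.Nat.ListAction using (sum)
open import Relation.Binary.PropositionalEquality using (_≡_)
open import Data.Bool.Properties using (T?)

record Graph (n : ℕ) : Set where
  field
    adj   : Fin n → Fin n → Bool
    sym   : ∀ u v → adj u v ≡ adj v u
    irrefl : ∀ v → adj v v ≡ false
open Graph public

data Reachable {n : ℕ} (G : Graph n) : Fin n → Fin n → Set where
  here : ∀ {v} → Reachable G v v
  step : ∀ {u w v} → adj G u w ≡ true → Reachable G w v → Reachable G u v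

Connected : ∀ {n} → Graph n → Set
Connected {n} G = ∀ (u v : Fin n) → Reachable G u v

degree : ∀ {n} → Graph n → Fin n → ℕ
degree {n} G v = length (filter (λ u → T? (adj G v u)) (allFin n))

-- An ordering is a bijection V → {1,…,n}; we use a permutation of Fin n,
-- with position  pos α v = 1 + toℕ (α v) ∈ {1,…,n}.
Ordering : ℕ → Set
Ordering n = Permutation′ n

pos : ∀ {n} → Ordering n → Fin n → ℕ
pos α v = suc (toℕ (α ⟨$⟩ʳ v))

minN : ∀ {n} → Graph n → (Fin n → ℕ) → Fin n → ℕ
minN {n} G p v = foldr (λ u m → if adj G v u then p u ⊓ m else m) (p v) (allFin n)

-- prf for a position function p (prf_α(G) is prf G (pos α)).
prf : ∀ {n} → Graph n → (Fin n → ℕ) → ℕ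
prf {n} G p = sum (map (λ v → p v ∸ minN G p v) (allFin n))

-- Position map of swap_{Y,X} for the α-consecutive pair given by a < b < c:
-- X occupies [a, b-1], Y occupies [b, c].
swapPos : ℕ → ℕ → ℕ → ℕ → ℕ
swapPos a b c i =
  if (a ≤ᵇ i) ∧ (suc i ≤ᵇ b) then i + (suc c ∸ b)
  else if (b ≤ᵇ i) ∧ (i ≤ᵇ c) then i ∸ (b ∸ a)
  else i

swapOrd : ∀ {n} → Ordering n → ℕ → ℕ → ℕ → Fin n → ℕ
swapOrd α a b c v = swapPos a b c (pos α v)

-- Under β the vertex x moves from position a to position a + |Y|, where |Y| = c + 1 − b, and
-- the leaves in Y move down but stay at or after position a. No vertex of N[x] thus drops below
-- min_α N[x], so the term of x grows by at most |Y|. Every leaf now precedes its only neighbour x,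
-- so its term becomes 0; the leaf at position c had term at least c − a ≥ |Y|, which pays for x.
-- Every other vertex keeps its position and has no neighbour in Y, so its term cannot grow.

module Submission where

open import Defs
open import Data.Nat using (ℕ; suc; _≤_; _<_; _∸_)
open import Data.Fin using (Fin)
open import Data.Product using (_×_)
open import Function.Bundles using (_⇔_)
open import Relation.Binary.PropositionalEquality using (_≡_)
open import Data.Bool using (true)

open import Data.Bool using (false; if_then_else_; _∧_)
open import Data.Bool.Properties using (T?; T-≡; if-cong)
open import Data.Fin using (toℕ; fromℕ<; _≟_) renaming (zero to fzero; suc to fsuc)
open import Data.Fin.Permutation using (_⟨$⟩ˡ_; inverseʳ)
open import Data.Fin.Properties using (toℕ-fromℕ<)
open import Data.List using (List; []; _∷_; map; foldr; filter; length; tabulate; allFin)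
open import Data.List.Membership.Propositional using (_∈_)
open import Data.List.Membership.Propositional.Properties using (∈-allFin; ∈-filter⁺)
open import Data.List.Properties using (map-tabulate)
open import Data.List.Relation.Unary.Any using (here; there)
open import Data.Nat using (zero; _+_; _⊓_; _≤ᵇ_; _≤?_; z≤n)
open import Data.Nat.ListAction using (sum)
open import Data.Nat.Properties hiding (_≟_)
open import Algebra.Properties.CommutativeSemigroup +-commutativeSemigroup using (interchange)
open import Data.Product using (_,_; proj₁; proj₂; ∃-syntax)
open import Function.Bundles using (Equivalence)
open import Relation.Binary.PropositionalEquality using (_≢_; refl; trans; cong; subst) renaming (sym to ≡-sym)
open import Relation.Nullary using (¬_; Dec; yes; no; does; _×-dec_; contradiction)
open import Relation.Nullary.Decidable using (dec-true; dec-false)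

open Equivalence using (to; from)

module _ {A : Set} where

  sum-map-mono : ∀ {f g : A → ℕ} → (∀ v → f v ≤ g v) → ∀ l → sum (map f l) ≤ sum (map g l)
  sum-map-mono f≤g []      = z≤n
  sum-map-mono f≤g (v ∷ l) = +-mono-≤ (f≤g v) (sum-map-mono f≤g l)

  sum-map-+ : ∀ (f g : A → ℕ) l →
    sum (map (λ v → f v + g v) l) ≡ sum (map f l) + sum (map g l)
  sum-map-+ f g []      = refl
  sum-map-+ f g (v ∷ l) =
    trans (cong (f v + g v +_) (sum-map-+ f g l)) (interchange (f v) (g v) _ _)

  ∈-length≡1 : ∀ {xs : List A} {u w} → length xs ≡ 1 → u ∈ xs → w ∈ xs → u ≡ w
  ∈-length≡1 {_ ∷ []} _ (here refl) (here refl) = refl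

indicator : ∀ {n} → Fin n → ℕ → Fin n → ℕ
indicator z k v = if does (v ≟ z) then k else 0

sum-tabulate-0 : ∀ n → sum (tabulate {n = n} (λ _ → 0)) ≡ 0
sum-tabulate-0 zero    = refl
sum-tabulate-0 (suc n) = sum-tabulate-0 n

sum-tabulate-indicator : ∀ {n} (z : Fin n) k → sum (tabulate (indicator z k)) ≡ k
sum-tabulate-indicator {suc n} fzero    k = trans (cong (k +_) (sum-tabulate-0 n)) (+-identityʳ k)
sum-tabulate-indicator {suc n} (fsuc z) k = sum-tabulate-indicator z k

sum-indicator : ∀ {n} (z : Fin n) k → sum (map (indicator z k) (allFin n)) ≡ k
sum-indicator z k = trans (cong sum (map-tabulate (λ v → v) (indicator z k))) (sum-tabulate-indicator z k)

-- Adding k at y on the left and at x on the right makes the comparison pointwise.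
sum-≤-transfer : ∀ {n} {f g : Fin n → ℕ} {x y : Fin n} k → x ≢ y →
  f x ≤ g x + k → f y + k ≤ g y → (∀ v → v ≢ x → v ≢ y → f v ≤ g v) →
  sum (map f (allFin n)) ≤ sum (map g (allFin n))
sum-≤-transfer {n} {f} {g} {x} {y} k x≢y fx≤gx+k fy+k≤gy f≤g = +-cancelʳ-≤ k _ _ (begin
  Σ f + k                                     ≡⟨ cong (Σ f +_) (sum-indicator y k) ⟨
  Σ f + Σ (indicator y k)                     ≡⟨ sum-map-+ f (indicator y k) (allFin n) ⟨
  Σ (λ v → f v + indicator y k v)             ≤⟨ sum-map-mono pointwise (allFin n) ⟩
  Σ (λ v → g v + indicator x k v)             ≡⟨ sum-map-+ g (indicator x k) (allFin n) ⟩
  Σ g + Σ (indicator x k)                     ≡⟨ cong (Σ g +_) (sum-indicator x k) ⟩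
  Σ g + k                                     ∎)
  where
  open ≤-Reasoning
  Σ : (Fin n → ℕ) → ℕ
  Σ h = sum (map h (allFin n))

  pointwise : ∀ v → f v + indicator y k v ≤ g v + indicator x k v
  pointwise v with v ≟ x | v ≟ y
  ... | yes refl | yes refl = contradiction refl x≢y
  ... | yes refl | no _     = ≤-trans (≤-reflexive (+-identityʳ (f v))) fx≤gx+k
  ... | no _     | yes refl = ≤-trans fy+k≤gy (≤-reflexive (≡-sym (+-identityʳ (g v))))
  ... | no v≢x   | no v≢y   = +-monoˡ-≤ 0 (f≤g v v≢x v≢y)

module _ {n} (G : Graph n) (p : Fin n → ℕ) (v : Fin n) where
  private
    minStep : Fin n → ℕ → ℕ
    minStep u m = if adj G v u then p u ⊓ m else m

    foldr-minStep-≤-init : ∀ l → foldr minStep (p v) l ≤ p v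
    foldr-minStep-≤-init []      = ≤-refl
    foldr-minStep-≤-init (u ∷ l) with adj G v u
    ... | true  = ≤-trans (m⊓n≤n _ _) (foldr-minStep-≤-init l)
    ... | false = foldr-minStep-≤-init l

    foldr-minStep-≤-adj : ∀ {u} l → u ∈ l → adj G v u ≡ true → foldr minStep (p v) l ≤ p u
    foldr-minStep-≤-adj (u ∷ l) (here refl) vu rewrite vu = m⊓n≤m _ _
    foldr-minStep-≤-adj (w ∷ l) (there u∈l) vu with adj G v w
    ... | true  = ≤-trans (m⊓n≤n _ _) (foldr-minStep-≤-adj l u∈l vu)
    ... | false = foldr-minStep-≤-adj l u∈l vu

    foldr-minStep-glb : ∀ {m} l → m ≤ p v → (∀ u → adj G v u ≡ true → m ≤ p u) →
      m ≤ foldr minStep (p v) l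
    foldr-minStep-glb []      m≤v m≤adj = m≤v
    foldr-minStep-glb (u ∷ l) m≤v m≤adj with adj G v u in vu
    ... | true  = ⊓-glb (m≤adj u vu) (foldr-minStep-glb l m≤v m≤adj)
    ... | false = foldr-minStep-glb l m≤v m≤adj

  minN-≤-self : minN G p v ≤ p v
  minN-≤-self = foldr-minStep-≤-init (allFin n)

  minN-≤-adj : ∀ {u} → adj G v u ≡ true → minN G p v ≤ p u
  minN-≤-adj {u} = foldr-minStep-≤-adj (allFin n) (∈-allFin u)

  minN-glb : ∀ {m} → m ≤ p v → (∀ u → adj G v u ≡ true → m ≤ p u) → m ≤ minN G p v
  minN-glb = foldr-minStep-glb (allFin n)

prfAt : ∀ {n} → Graph n → (Fin n → ℕ) → Fin n → ℕ
prfAt G p v = p v ∸ minN G p v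

degree≡1⇒adj-unique : ∀ {n} (G : Graph n) {y u w} → degree G y ≡ 1 →
  adj G y u ≡ true → adj G y w ≡ true → u ≡ w
degree≡1⇒adj-unique {n} G {y} deg≡1 yu yw = ∈-length≡1 deg≡1 (∈-neighbours yu) (∈-neighbours yw)
  where
  ∈-neighbours : ∀ {u} → adj G y u ≡ true → u ∈ filter (λ u → T? (adj G y u)) (allFin n)
  ∈-neighbours {u} yu = ∈-filter⁺ (λ u → T? (adj G y u)) (∈-allFin u) (from T-≡ yu)

pos-surjective : ∀ {n} (α : Ordering n) {k} → 1 ≤ k → k ≤ n → ∃[ v ] pos α v ≡ k
pos-surjective α {suc k} _ k<n =
  α ⟨$⟩ˡ fromℕ< k<n , cong suc (trans (cong toℕ (inverseʳ α)) (toℕ-fromℕ< k<n))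

module _ {m n o p : ℕ} where

  ≤ᵇ∧≤ᵇ≡true : m ≤ n → o ≤ p → ((m ≤ᵇ n) ∧ (o ≤ᵇ p)) ≡ true
  ≤ᵇ∧≤ᵇ≡true m≤n o≤p = dec-true (m ≤? n ×-dec o ≤? p) (m≤n , o≤p)

  ≤ᵇ∧≤ᵇ≡false : ¬ (m ≤ n × o ≤ p) → ((m ≤ᵇ n) ∧ (o ≤ᵇ p)) ≡ false
  ≤ᵇ∧≤ᵇ≡false = dec-false (m ≤? n ×-dec o ≤? p)

module _ {a b c i : ℕ} where

  swapPos-X : a ≤ i → i < b → swapPos a b c i ≡ i + (suc c ∸ b)
  swapPos-X a≤i i<b = if-cong (≤ᵇ∧≤ᵇ≡true a≤i i<b)

  swapPos-Y : b ≤ i → i ≤ c → swapPos a b c i ≡ i ∸ (b ∸ a)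
  swapPos-Y b≤i i≤c =
    trans (if-cong (≤ᵇ∧≤ᵇ≡false {m = a} λ (_ , i<b) → <⇒≱ i<b b≤i)) (if-cong (≤ᵇ∧≤ᵇ≡true b≤i i≤c))

  swapPos-fixed : ¬ (a ≤ i × i < b) → ¬ (b ≤ i × i ≤ c) → swapPos a b c i ≡ i
  swapPos-fixed ∉X ∉Y = trans (if-cong (≤ᵇ∧≤ᵇ≡false ∉X)) (if-cong (≤ᵇ∧≤ᵇ≡false ∉Y))

  ≤-swapPos : ¬ (b ≤ i × i ≤ c) → i ≤ swapPos a b c i
  ≤-swapPos ∉Y with a ≤? i ×-dec suc i ≤? b
  ... | yes (a≤i , i<b) = ≤-trans (m≤m+n i _) (≤-reflexive (≡-sym (swapPos-X a≤i i<b)))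
  ... | no ∉X           = ≤-reflexive (≡-sym (swapPos-fixed ∉X ∉Y))

  swapPos-Y-≥ : a ≤ b → b ≤ i → i ≤ c → a ≤ swapPos a b c i
  swapPos-Y-≥ a≤b b≤i i≤c = begin
    a                 ≡⟨ m∸[m∸n]≡n a≤b ⟨
    b ∸ (b ∸ a)       ≤⟨ ∸-monoˡ-≤ (b ∸ a) b≤i ⟩
    i ∸ (b ∸ a)       ≡⟨ swapPos-Y b≤i i≤c ⟨
    swapPos a b c i   ∎
    where open ≤-Reasoning

c∸[b∸a]≤a+[1+c∸b] : ∀ {a b c} → a ≤ b → b ≤ suc c → c ∸ (b ∸ a) ≤ a + (suc c ∸ b)
c∸[b∸a]≤a+[1+c∸b] {a} {b} {c} a≤b b≤1+c = m≤n+o⇒m∸n≤o c (b ∸ a) (begin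
  c                             ≤⟨ n≤1+n c ⟩
  suc c                         ≡⟨ m+[n∸m]≡n b≤1+c ⟨
  b + (suc c ∸ b)               ≡⟨ cong (_+ (suc c ∸ b)) (m∸n+n≡m a≤b) ⟨
  (b ∸ a) + a + (suc c ∸ b)     ≡⟨ +-assoc (b ∸ a) a (suc c ∸ b) ⟩
  (b ∸ a) + (a + (suc c ∸ b))   ∎)
  where open ≤-Reasoning

module PendantSwap {n} (G : Graph n) (α : Ordering n) (x : Fin n) {a b c : ℕ}
  (1≤a : 1 ≤ a) (a<b : a < b) (b<c : b < c) (c≤n : c ≤ n)
  (X≡[x] : ∀ v → ((a ≤ pos α v × pos α v ≤ b ∸ 1) ⇔ (v ≡ x)))
  (Y-leaves : ∀ y → b ≤ pos α y → pos α y ≤ c → degree G y ≡ 1 × adj G y x ≡ true) where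

  p q : Fin n → ℕ
  p = pos α
  q = swapOrd α a b c

  k : ℕ
  k = suc c ∸ b

  InY : Fin n → Set
  InY v = b ≤ p v × p v ≤ c

  InY? : ∀ v → Dec (InY v)
  InY? v = b ≤? p v ×-dec p v ≤? c

  ∉X : ∀ {v} → v ≢ x → ¬ (a ≤ p v × p v < b)
  ∉X v≢x (a≤v , v<b) = v≢x (to (X≡[x] _) (a≤v , ∸-monoˡ-≤ 1 v<b))

  p-x : p x ≡ a
  p-x = let z , p-z = pos-surjective α 1≤a (≤-trans (<⇒≤ a<b) (≤-trans (<⇒≤ b<c) c≤n))
            z≡x = to (X≡[x] z) (≤-reflexive (≡-sym p-z) , ≤-trans (≤-reflexive p-z) (∸-monoˡ-≤ 1 a<b))
        in trans (cong p (≡-sym z≡x)) p-z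

  x∉Y : ¬ InY x
  x∉Y (b≤x , _) = <⇒≱ (subst (_< b) (≡-sym p-x) a<b) b≤x

  private
    at-c : ∃[ v ] p v ≡ c
    at-c = pos-surjective α (≤-trans 1≤a (≤-trans (<⇒≤ a<b) (<⇒≤ b<c))) c≤n

  y-last : Fin n
  y-last = proj₁ at-c

  p-y-last : p y-last ≡ c
  p-y-last = proj₂ at-c

  y-last∈Y : InY y-last
  y-last∈Y = ≤-trans (<⇒≤ b<c) (≤-reflexive (≡-sym p-y-last)) , ≤-reflexive p-y-last

  x≢y-last : x ≢ y-last
  x≢y-last x≡y = <⇒≢ (<-trans a<b b<c) (trans (≡-sym p-x) (trans (cong p x≡y) p-y-last))

  Y-adj-x : ∀ {y} → InY y → adj G y x ≡ true
  Y-adj-x (b≤y , y≤c) = proj₂ (Y-leaves _ b≤y y≤c)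

  Y-adj⇒≡x : ∀ {y u} → InY y → adj G y u ≡ true → u ≡ x
  Y-adj⇒≡x y∈Y@(b≤y , y≤c) yu = degree≡1⇒adj-unique G (proj₁ (Y-leaves _ b≤y y≤c)) yu (Y-adj-x y∈Y)

  adj-Y⇒≡x : ∀ {v u} → InY u → adj G v u ≡ true → v ≡ x
  adj-Y⇒≡x {v} {u} u∈Y vu = Y-adj⇒≡x u∈Y (trans (Graph.sym G u v) vu)

  q-x : q x ≡ a + k
  q-x = trans (cong (swapPos a b c) p-x) (swapPos-X ≤-refl a<b)

  q-Y≤q-x : ∀ {y} → InY y → q y ≤ q x
  q-Y≤q-x {y} (b≤y , y≤c) = begin
    q y               ≡⟨ swapPos-Y {a = a} b≤y y≤c ⟩
    p y ∸ (b ∸ a)     ≤⟨ ∸-monoˡ-≤ (b ∸ a) y≤c ⟩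
    c ∸ (b ∸ a)       ≤⟨ c∸[b∸a]≤a+[1+c∸b] (<⇒≤ a<b) (≤-trans (<⇒≤ b<c) (n≤1+n c)) ⟩
    a + k             ≡⟨ q-x ⟨
    q x               ∎
    where open ≤-Reasoning

  minN-p≤minN-q : ∀ {v} → ¬ InY v → minN G p v ≤ minN G q v
  minN-p≤minN-q {v} v∉Y = minN-glb G q v (≤-trans (minN-≤-self G p v) (≤-swapPos {a = a} v∉Y)) bound
    where
    bound : ∀ u → adj G v u ≡ true → minN G p v ≤ q u
    bound u vu with InY? u
    ... | yes u∈Y@(b≤u , u≤c) = begin
      minN G p v   ≤⟨ minN-≤-self G p v ⟩
      p v          ≡⟨ cong p (adj-Y⇒≡x u∈Y vu) ⟩
      p x          ≡⟨ p-x ⟩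
      a            ≤⟨ swapPos-Y-≥ (<⇒≤ a<b) b≤u u≤c ⟩
      q u          ∎
      where open ≤-Reasoning
    ... | no u∉Y = ≤-trans (minN-≤-adj G p v vu) (≤-swapPos {a = a} u∉Y)

  prfAt-q-Y : ∀ {y} → InY y → prfAt G q y ≡ 0
  prfAt-q-Y {y} y∈Y = m≤n⇒m∸n≡0 (minN-glb G q y ≤-refl λ u yu →
    ≤-trans (q-Y≤q-x y∈Y) (≤-reflexive (cong q (≡-sym (Y-adj⇒≡x y∈Y yu)))))

  prfAt-q-x : prfAt G q x ≤ prfAt G p x + k
  prfAt-q-x = begin
    q x ∸ minN G q x        ≤⟨ ∸-monoʳ-≤ (q x) (minN-p≤minN-q x∉Y) ⟩
    q x ∸ minN G p x        ≡⟨ cong (_∸ minN G p x) q-x ⟩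
    (a + k) ∸ minN G p x    ≡⟨ +-∸-comm k (≤-trans (minN-≤-self G p x) (≤-reflexive p-x)) ⟩
    (a ∸ minN G p x) + k    ≡⟨ cong (λ t → (t ∸ minN G p x) + k) p-x ⟨
    prfAt G p x + k         ∎
    where open ≤-Reasoning

  prfAt-q-y-last : prfAt G q y-last + k ≤ prfAt G p y-last
  prfAt-q-y-last = begin
    prfAt G q y-last + k          ≡⟨ cong (_+ k) (prfAt-q-Y y-last∈Y) ⟩
    suc c ∸ b                     ≤⟨ ∸-monoʳ-≤ (suc c) a<b ⟩
    c ∸ a                         ≤⟨ ∸-monoʳ-≤ c minN≤a ⟩
    c ∸ minN G p y-last           ≡⟨ cong (_∸ minN G p y-last) p-y-last ⟨
    prfAt G p y-last              ∎
    where
    open ≤-Reasoning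
    minN≤a : minN G p y-last ≤ a
    minN≤a = ≤-trans (minN-≤-adj G p y-last (Y-adj-x y-last∈Y)) (≤-reflexive p-x)

  prfAt-q-other : ∀ {v} → v ≢ x → prfAt G q v ≤ prfAt G p v
  prfAt-q-other {v} v≢x with InY? v
  ... | yes v∈Y = ≤-trans (≤-reflexive (prfAt-q-Y v∈Y)) z≤n
  ... | no v∉Y  = begin
    q v ∸ minN G q v   ≤⟨ ∸-monoʳ-≤ (q v) (minN-p≤minN-q v∉Y) ⟩
    q v ∸ minN G p v   ≡⟨ cong (_∸ minN G p v) (swapPos-fixed {c = c} (∉X v≢x) v∉Y) ⟩
    prfAt G p v        ∎
    where open ≤-Reasoning

lemma3p3 : ∀ {n : ℕ} (G : Graph n) → Connected G → (α : Ordering n) →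
    (x : Fin n) (a b c : ℕ) → 1 ≤ a → a < b → b < c → c ≤ n →
    (∀ v → ((a ≤ pos α v × pos α v ≤ b ∸ 1) ⇔ (v ≡ x))) →
    (∀ y → b ≤ pos α y → pos α y ≤ c → degree G y ≡ 1 × adj G y x ≡ true) →
    prf G (swapOrd α a b c) ≤ prf G (pos α)
lemma3p3 G _ α x a b c 1≤a a<b b<c c≤n X≡[x] Y-leaves =
  sum-≤-transfer k x≢y-last prfAt-q-x prfAt-q-y-last (λ _ v≢x _ → prfAt-q-other v≢x)
  where open PendantSwap G α x 1≤a a<b b<c c≤n X≡[x] Y-leaves
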